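{- Let $\alpha\geq 1$ and let $(t_0,t_1)\in \mathcal{O}_F/p^\alpha\mathcal{O}_F\times (\mathcal{O}_F/p^\alpha\mathcal{O}_F)^{\mathrm{tr}=0}$. If \[ [t_0,t_1]\in I_\alpha := \left(\mathcal{O}_F/p^\alpha\mathcal{O}_F\right)^\times\times \left(\mathcal{O}_F/p^\alpha\mathcal{O}_F\right)^{\times,\mathrm{tr}=0}, \] then the group $\mathrm{SL}_2(\mathbb{Z}/p^\alpha\mathbb{Z})$ acts simply transitively on \[ \Sigma_{\alpha}[t_0,t_1]=\left\lbrace (v_0,v_1)\in \Sigma_\alpha : D(v_0,v_1)=(t_0,t_1)\right\rbrace. \]
   Context: Let $F$ be a real quadratic field with ring of integers $\mathcal{O}_F$, let $\sigma\in\mathrm{Gal}(F/\mathbb{Q})$ be the nontrivial automorphism, let $p$ be a rational prime, and put $\mathcal{O}_{F,p}=\mathcal{O}_F\otimes\mathbb{Z}_p$. For a $\mathbb{Z}_p$-module (resp. $\mathcal{O}_{F,p}$-module) $\Omega$, let $\Omega'$ denote the set of primitive elements of $\Omega$, i.e. elements not divisible by any non-unit of $\mathbb{Z}_p$ (resp. $\mathcal{O}_{F,p}$). For each integer $\alpha\geq1$ define \[ \Sigma_\alpha=\left(\mathbb{Z}/p^\alpha\mathbb{Z}\times \mathbb{Z}/p^\alpha\mathbb{Z}\right)'\times\left(\mathcal{O}_F/p^\alpha \times \mathcal{O}_F/p^\alpha\right)', \] equipped with the diagonal action of $\mathrm{GL}_2(\mathbb{Z}/p^\alpha\mathbb{Z})$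 by right multiplication (on row vectors). The quotient $\Sigma_\alpha/\mathrm{SL}_2(\mathbb{Z}/p^\alpha\mathbb{Z})$ carries the determinant map \[ D : \Sigma_\alpha/\mathrm{SL}_2(\mathbb{Z}/p^\alpha\mathbb{Z}) \longrightarrow \mathcal{O}_F/p^\alpha\mathcal{O}_F\times \left(\mathcal{O}_F/p^\alpha\mathcal{O}_F\right)^{\mathrm{tr}=0},\qquad D\left((x_0,y_0),(x_1,y_1)\right)=\left(\begin{vmatrix} x_0 & y_0 \\ x_1 & y_1 \end{vmatrix}, \begin{vmatrix} x_1 & y_1 \\ x_1^{\sigma} & y_1^{\sigma} \end{vmatrix}\right). \] For $(t_0,t_1)$ in the target, $\Sigma_\alpha[t_0,t_1]$ is the set of $(v_0,v_1)\in\Sigma_\alpha$ with $D(v_0,v_1)=(t_0,t_1)$. -}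

module Defs where

open import Data.Nat as ℕ using (ℕ; _∸_; _/_; _%_)
open import Data.Nat.Divisibility as ℕD using ()
open import Data.Integer as ℤ using (ℤ; +_; _+_; _*_; _-_; -_)
open import Data.Integer.Divisibility using (_∣_)
open import Data.Product using (_×_; _,_; ∃)
open import Relation.Nullary using (yes; no)
open import Relation.Binary.PropositionalEquality using (_≡_)

SquareFree : ℕ → Set
SquareFree d = ∀ m → (m ℕ.* m) ℕD.∣ d → m ≡ 1

-- Real quadratic field F = ℚ(√d), d ≥ 2 squarefree.  O_F = ℤ[ω] with
--   ω = (1+√d)/2  if d ≡ 1 (mod 4),   ω = √d  otherwise,
-- and ω² = ωtr d · ω + ωc d.
ωtr : ℕ → ℤ
ωtr d with d % 4 ℕ.≟ 1
... | yes _ = + 1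
... | no _ = + 0

ωc : ℕ → ℤ
ωc d with d % 4 ℕ.≟ 1
... | yes _ = + ((d ∸ 1) / 4)
... | no _ = + d

-- Everything modulo N (N = p^α in the statement); quotients are
-- represented by integer representatives with congruence mod N.
module QuadMod (d N : ℕ) where

  infix 4 _≈_ _≈F_ _≈M_ _≈Σ_
  infixl 6 _+F_ _-F_
  infixl 7 _*F_ _·F_

  _≈_ : ℤ → ℤ → Set
  a ≈ b = (+ N) ∣ (a - b)

  IsUnitℤ : ℤ → Set
  IsUnitℤ a = ∃ λ b → (a * b) ≈ + 1

  -- O_F/N : a + bω represented by (a , b)
  OF : Set
  OF = ℤ × ℤ

  _≈F_ : OF → OF → Set
  (a , b) ≈F (c , e) = (a ≈ c) × (b ≈ e)

  0F 1F : OF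
  0F = (+ 0 , + 0)
  1F = (+ 1 , + 0)

  ι : ℤ → OF
  ι a = (a , + 0)

  _+F_ : OF → OF → OF
  (a , b) +F (c , e) = (a + c , b + e)

  _-F_ : OF → OF → OF
  (a , b) -F (c , e) = (a - c , b - e)

  _*F_ : OF → OF → OF
  (a , b) *F (c , e) = (a * c + b * e * ωc d , a * e + b * c + b * e * ωtr d)

  _·F_ : ℤ → OF → OF
  k ·F (a , b) = (k * a , k * b)

  -- the nontrivial automorphism σ : ω ↦ ωtr d - ω
  conj : OF → OF
  conj (a , b) = (a + b * ωtr d , - b)

  IsUnitF : OF → Set
  IsUnitF x = ∃ λ y → (x *F y) ≈F 1F

  TraceZero : OF → Set
  TraceZero x = (x +F conj x) ≈F 0F

  PrimitiveZ : ℤ × ℤ → Set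
  PrimitiveZ (x , y) = ∀ c u w → x ≈ (c * u) → y ≈ (c * w) → IsUnitℤ c

  PrimitiveF : OF × OF → Set
  PrimitiveF (x , y) = ∀ c u w → x ≈F (c *F u) → y ≈F (c *F w) → IsUnitF c

  -- 2×2 matrices over ℤ/N : (a , b , c , e) = [[a , b] , [c , e]]
  Mat : Set
  Mat = ℤ × ℤ × ℤ × ℤ

  _≈M_ : Mat → Mat → Set
  (a , b , c , e) ≈M (a' , b' , c' , e') = (a ≈ a') × (b ≈ b') × (c ≈ c') × (e ≈ e')

  InSL2 : Mat → Set
  InSL2 (a , b , c , e) = (a * e - b * c) ≈ + 1

  -- right multiplication of row vectors
  actZ : ℤ × ℤ → Mat → ℤ × ℤ
  actZ (x , y) (a , b , c , e) = (x * a + y * c , x * b + y * e)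

  actF : OF × OF → Mat → OF × OF
  actF (x , y) (a , b , c , e) = ((a ·F x) +F (c ·F y) , (b ·F x) +F (e ·F y))

  -- ambient set containing Σ_α
  Sig : Set
  Sig = (ℤ × ℤ) × (OF × OF)

  act : Sig → Mat → Sig
  act (v₀ , v₁) g = (actZ v₀ g , actF v₁ g)

  _≈Σ_ : Sig → Sig → Set
  ((x₀ , y₀) , (x₁ , y₁)) ≈Σ ((x₀' , y₀') , (x₁' , y₁')) =
    (x₀ ≈ x₀') × (y₀ ≈ y₀') × (x₁ ≈F x₁') × (y₁ ≈F y₁')

  InΣ : Sig → Set
  InΣ (v₀ , v₁) = PrimitiveZ v₀ × PrimitiveF v₁

  D : Sig → OF × OF
  D ((x₀ , y₀) , (x₁ , y₁)) =
    ((ι x₀ *F y₁) -F (ι y₀ *F x₁) , (x₁ *F conj y₁) -F (y₁ *F conj x₁))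

  InΣt : OF → OF → Sig → Set
  InΣt t₀ t₁ v = InΣ v × (proj₁' (D v) ≈F t₀) × (proj₂' (D v) ≈F t₁)
    where
    proj₁' : OF × OF → OF
    proj₁' (a , _) = a
    proj₂' : OF × OF → OF
    proj₂' (_ , b) = b

  Iα : OF → OF → Set
  Iα t₀ t₁ = IsUnitF t₀ × IsUnitF t₁ × TraceZero t₁

-- Write v₁ = (x₁ , y₁) in the basis 1, ω of O_F/N: its coefficients form a matrix P with rows
-- r = row₀ v₁ and s = row₁ v₁, and g ∈ SL₂ acts by v₀ ↦ v₀ g, P ↦ P g. Both components of D are
-- 2×2 determinants, D₀ v = (v₀ ∧ r , v₀ ∧ s) and D₁ v = (r ∧ s)·(σω − ω), so D (v g) = det g · D v;
-- primitivity is preserved because v = (v g) adj g. If t₁ is a unit, the first coordinate k of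
-- (σω − ω) t₁⁻¹ inverts r ∧ s for every v ∈ Σ[t₀,t₁]. Hence for v, w ∈ Σ[t₀,t₁] the matrix
-- g = k · adj P · P′ is the only one with P g = P′; det g = k² (r ∧ s)(r′ ∧ s′) = 1, and v₀ g = w₀
-- because a row is determined by its pairings with the basis r′, s′, which D₀ fixes.

module Submission where

open import Defs
open import Data.Nat using (ℕ; _≤_; _^_)
open import Data.Nat.Primality using (Prime)
open import Data.Product using (_×_; _,_; ∃; proj₁; proj₂)
open import Data.Integer as ℤ using (ℤ; +_; _+_; _*_; _-_; -_; -1ℤ)
import Data.Integer.Properties as ℤ
open import Data.Integer.Divisibility using (_∣_)
open import Data.Integer.Divisibility.Signed using (∣ᵤ⇒∣; ∣⇒∣ᵤ; ∣m∣n⇒∣m+n; ∣m⇒∣m*n)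
open import Data.Integer.Tactic.RingSolver using (solve-∀)
open import Data.Nat.Divisibility using (_∣0)
open import Data.Product.Relation.Binary.Pointwise.NonDependent using (Pointwise; ×-setoid)
open import Relation.Binary.Core using (Rel)
open import Relation.Binary.Bundles using (Setoid)
open import Relation.Binary.Structures using (IsEquivalence)
open import Relation.Binary.PropositionalEquality using (_≡_; cong; cong₂; subst; module ≡-Reasoning)
import Relation.Binary.Reasoning.Setoid as SetoidReasoning
open import Level using (0ℓ; suc)
import Relation.Binary.PropositionalEquality as ≡

record RingCongruence ℓ : Set (suc ℓ) where
  infix 4 _∼_
  field
    _∼_           : Rel ℤ ℓ
    isEquivalence : IsEquivalence _∼_
    +-cong        : ∀ {a a′ b b′} → a ∼ a′ → b ∼ b′ → a + b ∼ a′ + b′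
    *-cong        : ∀ {a a′ b b′} → a ∼ a′ → b ∼ b′ → a * b ∼ a′ * b′
    -‿cong        : ∀ {a a′} → a ∼ a′ → - a ∼ - a′

module Action (d N : ℕ) where
  open QuadMod d N

  det : Mat → ℤ
  det (a , b , c , e) = a * e - b * c

  adj : Mat → Mat
  adj (a , b , c , e) = (e , - b , - c , a)

  infixl 7 _·M_
  _·M_ : ℤ → Mat → Mat
  k ·M (a , b , c , e) = (k * a , k * b , k * c , k * e)

  infix 8 _∧_
  _∧_ : ℤ × ℤ → ℤ × ℤ → ℤ
  (x , y) ∧ (x′ , y′) = x * y′ - y * x′

  row₀ row₁ : OF × OF → ℤ × ℤ
  row₀ ((a , _) , (c , _)) = (a , c)
  row₁ ((_ , b) , (_ , e)) = (b , e)

  ω θ : OF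
  ω = (+ 0 , + 1)
  θ = conj ω -F ω

  ∧-actZ : ∀ u w g → actZ u g ∧ actZ w g ≡ det g * (u ∧ w)
  ∧-actZ (x , y) (x′ , y′) (a , b , c , e) = identity x y x′ y′ a b c e
    where
    identity : ∀ x y x′ y′ a b c e →
      (x * a + y * c) * (x′ * b + y′ * e) - (x * b + y * e) * (x′ * a + y′ * c)
        ≡ (a * e - b * c) * (x * y′ - y * x′)
    identity = solve-∀

  actZ-adj : ∀ u g → actZ (actZ u g) (adj g) ≡ det g ·F u
  actZ-adj (x , y) (a , b , c , e) = cong₂ _,_ (first x y a b c e) (second x y a b c e)
    where
    first : ∀ x y a b c e → (x * a + y * c) * e + (x * b + y * e) * (- c) ≡ (a * e - b * c) * x
    first = solve-∀
    second : ∀ x y a b c e → (x * a + y * c) * (- b) + (x * b + y * e) * a ≡ (a * e - b * c) * y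
    second = solve-∀

  actZ-·F : ∀ k u g → actZ (k ·F u) g ≡ k ·F actZ u g
  actZ-·F k (x , y) (a , b , c , e) = cong₂ _,_ (identity k x y a c) (identity k x y b e)
    where
    identity : ∀ k x y a c → k * x * a + k * y * c ≡ k * (x * a + y * c)
    identity = solve-∀

  ·F-assoc : ∀ m k u → (m * k) ·F u ≡ m ·F (k ·F u)
  ·F-assoc m k (x , y) = cong₂ _,_ (ℤ.*-assoc m k x) (ℤ.*-assoc m k y)

  cramer : ∀ r s u → (r ∧ s) ·F u ≡ (u ∧ s) ·F r -F (u ∧ r) ·F s
  cramer (r₀ , r₁) (s₀ , s₁) (x , y) = cong₂ _,_ (first r₀ r₁ s₀ s₁ x y) (second r₀ r₁ s₀ s₁ x y)
    where
    first : ∀ r₀ r₁ s₀ s₁ x y →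
      (r₀ * s₁ - r₁ * s₀) * x ≡ (x * s₁ - y * s₀) * r₀ - (x * r₁ - y * r₀) * s₀
    first = solve-∀
    second : ∀ r₀ r₁ s₀ s₁ x y →
      (r₀ * s₁ - r₁ * s₀) * y ≡ (x * s₁ - y * s₀) * r₁ - (x * r₁ - y * r₀) * s₁
    second = solve-∀

  -- k · adj(P) · P′, where P and P′ are the matrices with rows r, s and r′, s′
  transporter : ℤ → (r s r′ s′ : ℤ × ℤ) → Mat
  transporter k (r₀ , r₁) (s₀ , s₁) (r₀′ , r₁′) (s₀′ , s₁′) =
    ( k * (s₁ * r₀′ - r₁ * s₀′) , k * (s₁ * r₁′ - r₁ * s₁′)
    , k * (r₀ * s₀′ - s₀ * r₀′) , k * (r₀ * s₁′ - s₀ * r₁′) )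

  actZ-transporter-r : ∀ k r s r′ s′ → actZ r (transporter k r s r′ s′) ≡ ((r ∧ s) * k) ·F r′
  actZ-transporter-r k (r₀ , r₁) (s₀ , s₁) (r₀′ , r₁′) (s₀′ , s₁′) =
    cong₂ _,_ (identity k r₀ r₁ s₀ s₁ r₀′ s₀′) (identity k r₀ r₁ s₀ s₁ r₁′ s₁′)
    where
    identity : ∀ k r₀ r₁ s₀ s₁ p q →
      r₀ * (k * (s₁ * p - r₁ * q)) + r₁ * (k * (r₀ * q - s₀ * p)) ≡ (r₀ * s₁ - r₁ * s₀) * k * p
    identity = solve-∀

  actZ-transporter-s : ∀ k r s r′ s′ → actZ s (transporter k r s r′ s′) ≡ ((r ∧ s) * k) ·F s′
  actZ-transporter-s k (r₀ , r₁) (s₀ , s₁) (r₀′ , r₁′) (s₀′ , s₁′) =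
    cong₂ _,_ (identity k r₀ r₁ s₀ s₁ r₀′ s₀′) (identity k r₀ r₁ s₀ s₁ r₁′ s₁′)
    where
    identity : ∀ k r₀ r₁ s₀ s₁ p q →
      s₀ * (k * (s₁ * p - r₁ * q)) + s₁ * (k * (r₀ * q - s₀ * p)) ≡ (r₀ * s₁ - r₁ * s₀) * k * q
    identity = solve-∀

  det-transporter : ∀ k r s r′ s′ → det (transporter k r s r′ s′) ≡ ((r ∧ s) * k) * ((r′ ∧ s′) * k)
  det-transporter k (r₀ , r₁) (s₀ , s₁) (r₀′ , r₁′) (s₀′ , s₁′) = identity k r₀ r₁ s₀ s₁ r₀′ r₁′ s₀′ s₁′
    where
    identity : ∀ k r₀ r₁ s₀ s₁ r₀′ r₁′ s₀′ s₁′ →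
      k * (s₁ * r₀′ - r₁ * s₀′) * (k * (r₀ * s₁′ - s₀ * r₁′))
        - k * (s₁ * r₁′ - r₁ * s₁′) * (k * (r₀ * s₀′ - s₀ * r₀′))
        ≡ (r₀ * s₁ - r₁ * s₀) * k * ((r₀′ * s₁′ - r₁′ * s₀′) * k)
    identity = solve-∀

  transporter-actZ : ∀ k r s g → transporter k r s (actZ r g) (actZ s g) ≡ ((r ∧ s) * k) ·M g
  transporter-actZ k (r₀ , r₁) (s₀ , s₁) (a , b , c , e) =
    cong₂ _,_ (upper k r₀ r₁ s₀ s₁ a c) (cong₂ _,_ (upper k r₀ r₁ s₀ s₁ b e)
      (cong₂ _,_ (lower k r₀ r₁ s₀ s₁ a c) (lower k r₀ r₁ s₀ s₁ b e)))
    where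
    upper : ∀ k r₀ r₁ s₀ s₁ p q →
      k * (s₁ * (r₀ * p + r₁ * q) - r₁ * (s₀ * p + s₁ * q)) ≡ (r₀ * s₁ - r₁ * s₀) * k * p
    upper = solve-∀
    lower : ∀ k r₀ r₁ s₀ s₁ p q →
      k * (r₀ * (s₀ * p + s₁ * q) - s₀ * (r₀ * p + r₁ * q)) ≡ (r₀ * s₁ - r₁ * s₀) * k * q
    lower = solve-∀

  ι-*F : ∀ a x → ι a *F x ≡ a ·F x
  ι-*F a (c , e) = cong₂ _,_ (first (ωc d) a c e) (second (ωtr d) a c e)
    where
    first : ∀ κ a c e → a * c + + 0 * e * κ ≡ a * c
    first = solve-∀
    second : ∀ τ a c e → a * e + + 0 * c + + 0 * e * τ ≡ a * e
    second = solve-∀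

  ·F-*F : ∀ k x y → (k ·F x) *F y ≡ k ·F (x *F y)
  ·F-*F k (a , b) (c , e) = cong₂ _,_ (first (ωc d) k a b c e) (second (ωtr d) k a b c e)
    where
    first : ∀ κ k a b c e → k * a * c + k * b * e * κ ≡ k * (a * c + b * e * κ)
    first = solve-∀
    second : ∀ τ k a b c e → k * a * e + k * b * c + k * b * e * τ ≡ k * (a * e + b * c + b * e * τ)
    second = solve-∀

  *F-linear : ∀ A C c u w → A ·F (c *F u) +F C ·F (c *F w) ≡ c *F (A ·F u +F C ·F w)
  *F-linear A C (c₀ , c₁) (u₀ , u₁) (w₀ , w₁) =
    cong₂ _,_ (first (ωc d) A C c₀ c₁ u₀ u₁ w₀ w₁) (second (ωtr d) A C c₀ c₁ u₀ u₁ w₀ w₁)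
    where
    first : ∀ κ A C c₀ c₁ u₀ u₁ w₀ w₁ →
      A * (c₀ * u₀ + c₁ * u₁ * κ) + C * (c₀ * w₀ + c₁ * w₁ * κ)
        ≡ c₀ * (A * u₀ + C * w₀) + c₁ * (A * u₁ + C * w₁) * κ
    first = solve-∀
    second : ∀ τ A C c₀ c₁ u₀ u₁ w₀ w₁ →
      A * (c₀ * u₁ + c₁ * u₀ + c₁ * u₁ * τ) + C * (c₀ * w₁ + c₁ * w₀ + c₁ * w₁ * τ)
        ≡ c₀ * (A * u₁ + C * w₁) + c₁ * (A * u₀ + C * w₀) + c₁ * (A * u₁ + C * w₁) * τ
    second = solve-∀

  actF-*F : ∀ c u w g →
    actF (c *F u , c *F w) g ≡ (c *F proj₁ (actF (u , w) g) , c *F proj₂ (actF (u , w) g))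
  actF-*F c u w (A , B , C , E) = cong₂ _,_ (*F-linear A C c u w) (*F-linear B E c u w)

  actF-adj : ∀ v g → actF (actF v g) (adj g) ≡ (det g ·F proj₁ v , det g ·F proj₂ v)
  actF-adj ((x₀ , x₁) , (y₀ , y₁)) (a , b , c , e) =
    cong₂ _,_ (cong₂ _,_ (first a b c e x₀ y₀) (first a b c e x₁ y₁))
              (cong₂ _,_ (second a b c e x₀ y₀) (second a b c e x₁ y₁))
    where
    first : ∀ a b c e x y → e * (a * x + c * y) + (- c) * (b * x + e * y) ≡ (a * e - b * c) * x
    first = solve-∀
    second : ∀ a b c e x y → (- b) * (a * x + c * y) + a * (b * x + e * y) ≡ (a * e - b * c) * y
    second = solve-∀

  row₀-actF : ∀ v₁ g → row₀ (actF v₁ g) ≡ actZ (row₀ v₁) g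
  row₀-actF ((a , _) , (c , _)) (A , B , C , E) =
    cong₂ _,_ (cong₂ _+_ (ℤ.*-comm A a) (ℤ.*-comm C c)) (cong₂ _+_ (ℤ.*-comm B a) (ℤ.*-comm E c))

  row₁-actF : ∀ v₁ g → row₁ (actF v₁ g) ≡ actZ (row₁ v₁) g
  row₁-actF ((_ , b) , (_ , e)) (A , B , C , E) =
    cong₂ _,_ (cong₂ _+_ (ℤ.*-comm A b) (ℤ.*-comm C e)) (cong₂ _+_ (ℤ.*-comm B b) (ℤ.*-comm E e))

  D₀-coords : ∀ v → proj₁ (D v) ≡ (proj₁ v ∧ row₀ (proj₂ v) , proj₁ v ∧ row₁ (proj₂ v))
  D₀-coords ((x₀ , y₀) , (x₁ , y₁)) = cong₂ _-F_ (ι-*F x₀ y₁) (ι-*F y₀ x₁)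

  D₁-coords : ∀ v → proj₂ (D v) ≡ (row₀ (proj₂ v) ∧ row₁ (proj₂ v)) ·F θ
  D₁-coords (_ , ((a , b) , (c , e))) = cong₂ _,_ (first (ωtr d) (ωc d) a b c e) (second (ωtr d) a b c e)
    where
    first : ∀ τ κ a b c e →
      a * (c + e * τ) + b * (- e) * κ - (c * (a + b * τ) + e * (- b) * κ)
        ≡ (a * e - c * b) * (+ 0 + + 1 * τ - + 0)
    first = solve-∀
    second : ∀ τ a b c e →
      a * (- e) + b * (c + e * τ) + b * (- e) * τ - (c * (- b) + e * (a + b * τ) + e * (- b) * τ)
        ≡ (a * e - c * b) * (- (+ 1) - + 1)
    second = solve-∀

  D₀-act : ∀ v g → proj₁ (D (act v g)) ≡ det g ·F proj₁ (D v)
  D₀-act (v₀ , v₁) g = begin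
    proj₁ (D (act (v₀ , v₁) g))
      ≡⟨ D₀-coords (act (v₀ , v₁) g) ⟩
    (actZ v₀ g ∧ row₀ (actF v₁ g) , actZ v₀ g ∧ row₁ (actF v₁ g))
      ≡⟨ cong₂ (λ r s → (actZ v₀ g ∧ r , actZ v₀ g ∧ s)) (row₀-actF v₁ g) (row₁-actF v₁ g) ⟩
    (actZ v₀ g ∧ actZ (row₀ v₁) g , actZ v₀ g ∧ actZ (row₁ v₁) g)
      ≡⟨ cong₂ _,_ (∧-actZ v₀ (row₀ v₁) g) (∧-actZ v₀ (row₁ v₁) g) ⟩
    det g ·F (v₀ ∧ row₀ v₁ , v₀ ∧ row₁ v₁)
      ≡⟨ cong (det g ·F_) (D₀-coords (v₀ , v₁)) ⟨
    det g ·F proj₁ (D (v₀ , v₁)) ∎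
    where open ≡-Reasoning

  D₁-act : ∀ v g → proj₂ (D (act v g)) ≡ det g ·F proj₂ (D v)
  D₁-act (v₀ , v₁) g = begin
    proj₂ (D (act (v₀ , v₁) g))
      ≡⟨ D₁-coords (act (v₀ , v₁) g) ⟩
    (row₀ (actF v₁ g) ∧ row₁ (actF v₁ g)) ·F θ
      ≡⟨ cong₂ (λ r s → (r ∧ s) ·F θ) (row₀-actF v₁ g) (row₁-actF v₁ g) ⟩
    (actZ (row₀ v₁) g ∧ actZ (row₁ v₁) g) ·F θ
      ≡⟨ cong (_·F θ) (∧-actZ (row₀ v₁) (row₁ v₁) g) ⟩
    (det g * (row₀ v₁ ∧ row₁ v₁)) ·F θ
      ≡⟨ ·F-assoc (det g) (row₀ v₁ ∧ row₁ v₁) θ ⟩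
    det g ·F ((row₀ v₁ ∧ row₁ v₁) ·F θ)
      ≡⟨ cong (det g ·F_) (D₁-coords (v₀ , v₁)) ⟨
    det g ·F proj₂ (D (v₀ , v₁)) ∎
    where open ≡-Reasoning

  module Modulo {ℓ} (C : RingCongruence ℓ) where

    open RingCongruence C
    open IsEquivalence isEquivalence

    infix 4 _∼²_ _∼⁴_ _∼ₘ_
    _∼²_ : Rel (ℤ × ℤ) ℓ
    _∼²_ = Pointwise _∼_ _∼_
    _∼⁴_ : Rel (OF × OF) ℓ
    _∼⁴_ = Pointwise _∼²_ _∼²_
    _∼ₘ_ : Rel Mat ℓ
    _∼ₘ_ = Pointwise _∼_ (Pointwise _∼_ (Pointwise _∼_ _∼_))

    ∼-setoid : Setoid _ _
    ∼-setoid = record { isEquivalence = isEquivalence }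
    ∼²-setoid : Setoid _ _
    ∼²-setoid = ×-setoid ∼-setoid ∼-setoid
    ∼⁴-setoid : Setoid _ _
    ∼⁴-setoid = ×-setoid ∼²-setoid ∼²-setoid
    ∼ₘ-setoid : Setoid _ _
    ∼ₘ-setoid = ×-setoid ∼-setoid (×-setoid ∼-setoid ∼²-setoid)

    open Setoid ∼²-setoid using ()
      renaming (refl to ∼²-refl; sym to ∼²-sym; trans to ∼²-trans; reflexive to ∼²-reflexive)

    *-congʳ : ∀ c {a a′} → a ∼ a′ → a * c ∼ a′ * c
    *-congʳ c p = *-cong p (refl {c})

    *-congˡ : ∀ c {b b′} → b ∼ b′ → c * b ∼ c * b′
    *-congˡ c p = *-cong (refl {c}) p

    one-* : ∀ {k} a → k ∼ + 1 → k * a ∼ a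
    one-* a k∼1 = trans (*-congʳ a k∼1) (reflexive (ℤ.*-identityˡ a))

    one-·F : ∀ {k} x → k ∼ + 1 → k ·F x ∼² x
    one-·F (a , b) k∼1 = one-* a k∼1 , one-* b k∼1

    one-·M : ∀ {k} g → k ∼ + 1 → k ·M g ∼ₘ g
    one-·M (a , b , c , e) k∼1 = one-* a k∼1 , one-* b k∼1 , one-* c k∼1 , one-* e k∼1

    ·F-congˡ : ∀ {k k′} x → k ∼ k′ → k ·F x ∼² k′ ·F x
    ·F-congˡ (a , b) p = *-congʳ a p , *-congʳ b p

    ·F-congʳ : ∀ k {x y} → x ∼² y → k ·F x ∼² k ·F y
    ·F-congʳ k (p , q) = *-congˡ k p , *-congˡ k q

    +F-cong : ∀ {x x′ y y′} → x ∼² x′ → y ∼² y′ → x +F y ∼² x′ +F y′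
    +F-cong (p , q) (p′ , q′) = +-cong p p′ , +-cong q q′

    -F-cong : ∀ {x x′ y y′} → x ∼² x′ → y ∼² y′ → x -F y ∼² x′ -F y′
    -F-cong (p , q) (p′ , q′) = +-cong p (-‿cong p′) , +-cong q (-‿cong q′)

    *F-congˡ : ∀ {x x′} y → x ∼² x′ → x *F y ∼² x′ *F y
    *F-congˡ (c , e) (p , q) =
      +-cong (*-congʳ c p) (*-congʳ (ωc d) (*-congʳ e q)) ,
      +-cong (+-cong (*-congʳ e p) (*-congʳ c q)) (*-congʳ (ωtr d) (*-congʳ e q))

    ∧-cong : ∀ {u u′ w w′} → u ∼² u′ → w ∼² w′ → u ∧ w ∼ u′ ∧ w′
    ∧-cong (p , q) (p′ , q′) = +-cong (*-cong p q′) (-‿cong (*-cong q p′))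

    actZ-congˡ : ∀ {u u′} g → u ∼² u′ → actZ u g ∼² actZ u′ g
    actZ-congˡ (a , b , c , e) (p , q) =
      +-cong (*-congʳ a p) (*-congʳ c q) , +-cong (*-congʳ b p) (*-congʳ e q)

    actF-congˡ : ∀ {v v′} g → v ∼⁴ v′ → actF v g ∼⁴ actF v′ g
    actF-congˡ (a , b , c , e) (p , q) =
      +F-cong (·F-congʳ a p) (·F-congʳ c q) , +F-cong (·F-congʳ b p) (·F-congʳ e q)

    transporter-cong : ∀ k r s {r′ r″ s′ s″} → r′ ∼² r″ → s′ ∼² s″ →
      transporter k r s r′ s′ ∼ₘ transporter k r s r″ s″
    transporter-cong k (r₀ , r₁) (s₀ , s₁) (p₀ , p₁) (q₀ , q₁) =
      entry s₁ r₁ p₀ q₀ , entry s₁ r₁ p₁ q₁ , entry r₀ s₀ q₀ p₀ , entry r₀ s₀ q₁ p₁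
      where
      entry : ∀ a b {x x′ y y′} → x ∼ x′ → y ∼ y′ → k * (a * x - b * y) ∼ k * (a * x′ - b * y′)
      entry a b p q = *-congˡ k (+-cong (*-congˡ a p) (-‿cong (*-congˡ b q)))

    ∧-invariant : ∀ u w g {u′ w′} → det g ∼ + 1 → u′ ∼² actZ u g → w′ ∼² actZ w g → u′ ∧ w′ ∼ u ∧ w
    ∧-invariant u w g {u′} {w′} g∈SL₂ p q = begin
      u′ ∧ w′              ≈⟨ ∧-cong p q ⟩
      actZ u g ∧ actZ w g  ≡⟨ ∧-actZ u w g ⟩
      det g * (u ∧ w)      ≈⟨ one-* (u ∧ w) g∈SL₂ ⟩
      u ∧ w                ∎
      where open SetoidReasoning ∼-setoid

    ∧-determines : ∀ k r s u u′ → (r ∧ s) * k ∼ + 1 → u ∧ r ∼ u′ ∧ r → u ∧ s ∼ u′ ∧ s → u ∼² u′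
    ∧-determines k r s u u′ rs·k∼1 p q = begin
      u                                          ≈⟨ one-·F u rs·k∼1 ⟨
      ((r ∧ s) * k) ·F u                         ≡⟨ cong (_·F u) (ℤ.*-comm (r ∧ s) k) ⟩
      (k * (r ∧ s)) ·F u                         ≡⟨ ·F-assoc k (r ∧ s) u ⟩
      k ·F ((r ∧ s) ·F u)                        ≡⟨ cong (k ·F_) (cramer r s u) ⟩
      k ·F ((u ∧ s) ·F r -F (u ∧ r) ·F s)        ≈⟨ ·F-congʳ k (-F-cong (·F-congˡ r q) (·F-congˡ s p)) ⟩
      k ·F ((u′ ∧ s) ·F r -F (u′ ∧ r) ·F s)      ≡⟨ cong (k ·F_) (cramer r s u′) ⟨
      k ·F ((r ∧ s) ·F u′)                       ≡⟨ ·F-assoc k (r ∧ s) u′ ⟨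
      (k * (r ∧ s)) ·F u′                        ≡⟨ cong (_·F u′) (ℤ.*-comm (r ∧ s) k) ⟨
      ((r ∧ s) * k) ·F u′                        ≈⟨ one-·F u′ rs·k∼1 ⟩
      u′                                         ∎
      where open SetoidReasoning ∼²-setoid

    actZ-pullback : ∀ v g c u w → det g ∼ + 1 → actZ v g ∼² c ·F (u , w) → v ∼² c ·F actZ (u , w) (adj g)
    actZ-pullback v g c u w g∈SL₂ p = begin
      v                            ≈⟨ one-·F v g∈SL₂ ⟨
      det g ·F v                   ≡⟨ actZ-adj v g ⟨
      actZ (actZ v g) (adj g)      ≈⟨ actZ-congˡ (adj g) p ⟩
      actZ (c ·F (u , w)) (adj g)  ≡⟨ actZ-·F c (u , w) (adj g) ⟩
      c ·F actZ (u , w) (adj g)    ∎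
      where open SetoidReasoning ∼²-setoid

    actF-pullback : ∀ v g c u w → det g ∼ + 1 → actF v g ∼⁴ (c *F u , c *F w) →
      v ∼⁴ (c *F proj₁ (actF (u , w) (adj g)) , c *F proj₂ (actF (u , w) (adj g)))
    actF-pullback v g c u w g∈SL₂ p = begin
      v                                      ≈⟨ one-·F (proj₁ v) g∈SL₂ , one-·F (proj₂ v) g∈SL₂ ⟨
      (det g ·F proj₁ v , det g ·F proj₂ v)  ≡⟨ actF-adj v g ⟨
      actF (actF v g) (adj g)                ≈⟨ actF-congˡ (adj g) p ⟩
      actF (c *F u , c *F w) (adj g)         ≡⟨ actF-*F c u w (adj g) ⟩
      (c *F proj₁ (actF (u , w) (adj g)) , c *F proj₂ (actF (u , w) (adj g))) ∎
      where open SetoidReasoning ∼⁴-setoid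

    module Frame (k : ℤ) (r s r′ s′ : ℤ × ℤ)
                 (rs·k∼1 : (r ∧ s) * k ∼ + 1) (r′s′·k∼1 : (r′ ∧ s′) * k ∼ + 1) where

      T : Mat
      T = transporter k r s r′ s′

      T∈SL₂ : det T ∼ + 1
      T∈SL₂ = begin
        det T                              ≡⟨ det-transporter k r s r′ s′ ⟩
        ((r ∧ s) * k) * ((r′ ∧ s′) * k)    ≈⟨ *-cong rs·k∼1 r′s′·k∼1 ⟩
        + 1                                ∎
        where open SetoidReasoning ∼-setoid

      T-sends-r : actZ r T ∼² r′
      T-sends-r = begin
        actZ r T             ≡⟨ actZ-transporter-r k r s r′ s′ ⟩
        ((r ∧ s) * k) ·F r′  ≈⟨ one-·F r′ rs·k∼1 ⟩
        r′                   ∎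
        where open SetoidReasoning ∼²-setoid

      T-sends-s : actZ s T ∼² s′
      T-sends-s = begin
        actZ s T             ≡⟨ actZ-transporter-s k r s r′ s′ ⟩
        ((r ∧ s) * k) ·F s′  ≈⟨ one-·F s′ rs·k∼1 ⟩
        s′                   ∎
        where open SetoidReasoning ∼²-setoid

      T-unique : ∀ g → actZ r g ∼² r′ → actZ s g ∼² s′ → g ∼ₘ T
      T-unique g p q = begin
        g                                       ≈⟨ one-·M g rs·k∼1 ⟨
        ((r ∧ s) * k) ·M g                      ≡⟨ transporter-actZ k r s g ⟨
        transporter k r s (actZ r g) (actZ s g) ≈⟨ transporter-cong k r s p q ⟩
        T                                       ∎
        where open SetoidReasoning ∼ₘ-setoid

      T-moves : ∀ u u′ → u ∧ r ∼ u′ ∧ r′ → u ∧ s ∼ u′ ∧ s′ → actZ u T ∼² u′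
      T-moves u u′ p q =
        ∧-determines k r′ s′ (actZ u T) u′ r′s′·k∼1
          (trans (∧-invariant u r T T∈SL₂ ∼²-refl (∼²-sym T-sends-r)) p)
          (trans (∧-invariant u s T T∈SL₂ ∼²-refl (∼²-sym T-sends-s)) q)

    D₀-preserved : ∀ v g t₀ → det g ∼ + 1 → proj₁ (D v) ∼² t₀ → proj₁ (D (act v g)) ∼² t₀
    D₀-preserved v g t₀ g∈SL₂ p = begin
      proj₁ (D (act v g))      ≡⟨ D₀-act v g ⟩
      det g ·F proj₁ (D v)     ≈⟨ one-·F (proj₁ (D v)) g∈SL₂ ⟩
      proj₁ (D v)              ≈⟨ p ⟩
      t₀                       ∎
      where open SetoidReasoning ∼²-setoid

    D₁-preserved : ∀ v g t₁ → det g ∼ + 1 → proj₂ (D v) ∼² t₁ → proj₂ (D (act v g)) ∼² t₁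
    D₁-preserved v g t₁ g∈SL₂ p = begin
      proj₂ (D (act v g))      ≡⟨ D₁-act v g ⟩
      det g ·F proj₂ (D v)     ≈⟨ one-·F (proj₂ (D v)) g∈SL₂ ⟩
      proj₂ (D v)              ≈⟨ p ⟩
      t₁                       ∎
      where open SetoidReasoning ∼²-setoid

    ∧-inverse : ∀ v t₁ q → proj₂ (D v) ∼² t₁ → t₁ *F q ∼² 1F →
      (row₀ (proj₂ v) ∧ row₁ (proj₂ v)) * proj₁ (θ *F q) ∼ + 1
    ∧-inverse v t₁ q p t₁q∼1 = proj₁ (begin
      δ ·F (θ *F q)            ≡⟨ ·F-*F δ θ q ⟨
      (δ ·F θ) *F q            ≡⟨ cong (_*F q) (D₁-coords v) ⟨
      proj₂ (D v) *F q         ≈⟨ *F-congˡ q p ⟩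
      t₁ *F q                  ≈⟨ t₁q∼1 ⟩
      1F                       ∎)
      where
      open SetoidReasoning ∼²-setoid
      δ : ℤ
      δ = row₀ (proj₂ v) ∧ row₁ (proj₂ v)

    D₀-pairings : ∀ v w t₀ → proj₁ (D v) ∼² t₀ → proj₁ (D w) ∼² t₀ →
      (proj₁ v ∧ row₀ (proj₂ v) , proj₁ v ∧ row₁ (proj₂ v))
        ∼² (proj₁ w ∧ row₀ (proj₂ w) , proj₁ w ∧ row₁ (proj₂ w))
    D₀-pairings v w t₀ p q = begin
      (proj₁ v ∧ row₀ (proj₂ v) , proj₁ v ∧ row₁ (proj₂ v))  ≡⟨ D₀-coords v ⟨
      proj₁ (D v)                                            ≈⟨ p ⟩
      t₀                                                     ≈⟨ q ⟨
      proj₁ (D w)                                            ≡⟨ D₀-coords w ⟩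
      (proj₁ w ∧ row₀ (proj₂ w) , proj₁ w ∧ row₁ (proj₂ w))  ∎
      where open SetoidReasoning ∼²-setoid

    rows⇒∼⁴ : ∀ x y → row₀ x ∼² row₀ y → row₁ x ∼² row₁ y → x ∼⁴ y
    rows⇒∼⁴ _ _ (p₀ , q₀) (p₁ , q₁) = (p₀ , p₁) , (q₀ , q₁)

    ∼⁴⇒rows : ∀ x y → x ∼⁴ y → row₀ x ∼² row₀ y × row₁ x ∼² row₁ y
    ∼⁴⇒rows _ _ ((p₀ , p₁) , (q₀ , q₁)) = (p₀ , q₀) , (p₁ , q₁)

    actF-by-rows : ∀ v₁ w₁ g →
      actZ (row₀ v₁) g ∼² row₀ w₁ → actZ (row₁ v₁) g ∼² row₁ w₁ → actF v₁ g ∼⁴ w₁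
    actF-by-rows v₁ w₁ g p q = rows⇒∼⁴ (actF v₁ g) w₁
      (∼²-trans (∼²-reflexive (row₀-actF v₁ g)) p) (∼²-trans (∼²-reflexive (row₁-actF v₁ g)) q)

    rows-by-actF : ∀ v₁ w₁ g →
      actF v₁ g ∼⁴ w₁ → actZ (row₀ v₁) g ∼² row₀ w₁ × actZ (row₁ v₁) g ∼² row₁ w₁
    rows-by-actF v₁ w₁ g p =
      ∼²-trans (∼²-sym (∼²-reflexive (row₀-actF v₁ g))) (proj₁ rows) ,
      ∼²-trans (∼²-sym (∼²-reflexive (row₁-actF v₁ g))) (proj₂ rows)
      where
      rows : row₀ (actF v₁ g) ∼² row₀ w₁ × row₁ (actF v₁ g) ∼² row₁ w₁
      rows = ∼⁴⇒rows (actF v₁ g) w₁ p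

  private
    +-multiple : ∀ x y → + N ∣ x → + N ∣ y → + N ∣ x + y
    +-multiple x y p q = ∣⇒∣ᵤ (∣m∣n⇒∣m+n (∣ᵤ⇒∣ {+ N} {x} p) (∣ᵤ⇒∣ {+ N} {y} q))

    *-multiple : ∀ x y → + N ∣ x → + N ∣ x * y
    *-multiple x y p = ∣⇒∣ᵤ (∣m⇒∣m*n y (∣ᵤ⇒∣ {+ N} {x} p))

    difference : ∀ a b c → a - b ≡ c → + N ∣ c → a ≈ b
    difference a b c a-b≡c = subst (+ N ∣_) (≡.sym a-b≡c)

  ℤ/N : RingCongruence 0ℓ
  ℤ/N = record
    { _∼_           = _≈_
    ; isEquivalence = record
      { refl  = λ {a} → difference a a (+ 0) (ℤ.+-inverseʳ a) (N ∣0)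
      ; sym   = λ {a} {b} p → difference b a ((a - b) * -1ℤ) (swap a b) (*-multiple (a - b) -1ℤ p)
      ; trans = λ {a} {b} {c} p q →
          difference a c ((a - b) + (b - c)) (chain a b c) (+-multiple (a - b) (b - c) p q)
      }
    ; +-cong        = λ {a} {a′} {b} {b′} p q →
        difference (a + b) (a′ + b′) ((a - a′) + (b - b′)) (sum a a′ b b′)
          (+-multiple (a - a′) (b - b′) p q)
    ; *-cong        = λ {a} {a′} {b} {b′} p q →
        difference (a * b) (a′ * b′) ((a - a′) * b + (b - b′) * a′) (product a a′ b b′)
          (+-multiple ((a - a′) * b) ((b - b′) * a′) (*-multiple (a - a′) b p) (*-multiple (b - b′) a′ q))
    ; -‿cong        = λ {a} {a′} p →
        difference (- a) (- a′) ((a - a′) * -1ℤ) (negation a a′) (*-multiple (a - a′) -1ℤ p)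
    }
    where
    swap : ∀ a b → b - a ≡ (a - b) * -1ℤ
    swap = solve-∀
    chain : ∀ a b c → a - c ≡ (a - b) + (b - c)
    chain = solve-∀
    sum : ∀ a a′ b b′ → (a + b) - (a′ + b′) ≡ (a - a′) + (b - b′)
    sum = solve-∀
    product : ∀ a a′ b b′ → a * b - a′ * b′ ≡ (a - a′) * b + (b - b′) * a′
    product = solve-∀
    negation : ∀ a a′ → - a - - a′ ≡ (a - a′) * -1ℤ
    negation = solve-∀

  open Modulo ℤ/N

  primitiveZ-act : ∀ v g → InSL2 g → PrimitiveZ v → PrimitiveZ (actZ v g)
  primitiveZ-act v g g∈SL₂ prim c u w p q = prim c (proj₁ v′) (proj₂ v′) (proj₁ pulled) (proj₂ pulled)
    where
    v′ : ℤ × ℤ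
    v′ = actZ (u , w) (adj g)
    pulled : v ∼² c ·F v′
    pulled = actZ-pullback v g c u w g∈SL₂ (p , q)

  primitiveF-act : ∀ v g → InSL2 g → PrimitiveF v → PrimitiveF (actF v g)
  primitiveF-act v g g∈SL₂ prim c u w p q = prim c (proj₁ v′) (proj₂ v′) (proj₁ pulled) (proj₂ pulled)
    where
    v′ : OF × OF
    v′ = actF (u , w) (adj g)
    pulled : v ∼⁴ (c *F proj₁ v′ , c *F proj₂ v′)
    pulled = actF-pullback v g c u w g∈SL₂ (p , q)

  act-preserves-Σ[t] : ∀ t₀ t₁ v g → InΣt t₀ t₁ v → InSL2 g → InΣt t₀ t₁ (act v g)
  act-preserves-Σ[t] t₀ t₁ (v₀ , v₁) g ((prim₀ , prim₁) , D₀v , D₁v) g∈SL₂ =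
    (primitiveZ-act v₀ g g∈SL₂ prim₀ , primitiveF-act v₁ g g∈SL₂ prim₁) ,
    D₀-preserved (v₀ , v₁) g t₀ g∈SL₂ D₀v , D₁-preserved (v₀ , v₁) g t₁ g∈SL₂ D₁v

  act-simply-transitive : ∀ t₀ t₁ → IsUnitF t₁ → ∀ v w → InΣt t₀ t₁ v → InΣt t₀ t₁ w →
    ∃ λ g → InSL2 g × (act v g ≈Σ w) × (∀ g′ → InSL2 g′ → act v g′ ≈Σ w → g′ ≈M g)
  act-simply-transitive t₀ t₁ (q , t₁q≈1) (v₀ , v₁) (w₀ , w₁) (_ , D₀v , D₁v) (_ , D₀w , D₁w) =
    T , T∈SL₂ , (proj₁ moves-v₀ , proj₂ moves-v₀ , actF-by-rows v₁ w₁ T T-sends-r T-sends-s) , unique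
    where
    open Frame (proj₁ (θ *F q)) (row₀ v₁) (row₁ v₁) (row₀ w₁) (row₁ w₁)
               (∧-inverse (v₀ , v₁) t₁ q D₁v t₁q≈1) (∧-inverse (w₀ , w₁) t₁ q D₁w t₁q≈1)
    pairings : (v₀ ∧ row₀ v₁ , v₀ ∧ row₁ v₁) ∼² (w₀ ∧ row₀ w₁ , w₀ ∧ row₁ w₁)
    pairings = D₀-pairings (v₀ , v₁) (w₀ , w₁) t₀ D₀v D₀w
    moves-v₀ : actZ v₀ T ∼² w₀
    moves-v₀ = T-moves v₀ w₀ (proj₁ pairings) (proj₂ pairings)
    unique : ∀ g′ → InSL2 g′ → act (v₀ , v₁) g′ ≈Σ (w₀ , w₁) → g′ ≈M T
    unique g′ _ (_ , _ , x₁≈ , y₁≈) = T-unique g′ (proj₁ rows) (proj₂ rows)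
      where
      rows : actZ (row₀ v₁) g′ ∼² row₀ w₁ × actZ (row₁ v₁) g′ ∼² row₁ w₁
      rows = rows-by-actF v₁ w₁ g′ (x₁≈ , y₁≈)

lemma4p1 : (d : ℕ) → 2 ≤ d → SquareFree d →
    (p : ℕ) → Prime p → (α : ℕ) → 1 ≤ α →
    let open QuadMod d (p ^ α) in
    (t₀ t₁ : OF) → TraceZero t₁ → Iα t₀ t₁ →
    ((v : Sig) (g : Mat) → InΣt t₀ t₁ v → InSL2 g → InΣt t₀ t₁ (act v g))
    × ((v w : Sig) → InΣt t₀ t₁ v → InΣt t₀ t₁ w →
        ∃ λ g → InSL2 g × (act v g ≈Σ w)
          × ((g' : Mat) → InSL2 g' → act v g' ≈Σ w → g' ≈M g))
lemma4p1 d _ _ p _ α _ t₀ t₁ _ (_ , t₁-unit , _) =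
  act-preserves-Σ[t] t₀ t₁ , act-simply-transitive t₀ t₁ t₁-unit
  where open Action d (p ^ α)
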